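{- Let $\mathcal{Y}=(Y_1,\ldots,Y_r)$ be a presentation of a transversal matroid $N$, and suppose that for each $e\in E(N)$ the support $s_{\mathcal{Y}}(e)$ is an interval in $[r]$. Then (1) for every circuit $C$ of $N$, the support $s_{\mathcal{Y}}(C)$ is an interval in $[r]$; and (2) for every connected flat $F$ of $N$ with $|F|>1$, the support $s_{\mathcal{Y}}(F)$ is an interval $I$ of $[r]$ and $F=\{e\in E(N): s_{\mathcal{Y}}(e)\subseteq I\}$.
   Context: A presentation of a transversal matroid $N$ is a family $(Y_1,\ldots,Y_r)$ of subsets of $E(N)$ such that the independent sets of $N$ are exactly the partial transversals, i.e. sets $I$ admitting an injection $\phi:I\to[r]$ with $e\in Y_{\phi(e)}$ for all $e\in I$. The support of $e\in E(N)$ is $s_{\mathcal{Y}}(e)=\{i\in[r]: e\in Y_i\}$, and the support of $X\subseteq E(N)$ is $s_{\mathcal{Y}}(X)=\bigcup_{e\in X}s_{\mathcal{Y}}(e)$. An interval in $[r]$ is a set $\{a,a+1,\ldots,b\}$. A connected flat is a flat $F$ such that $N|F$ is connected. -}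

module Defs where

open import Data.Nat using (ℕ; _≤_; _<_)
open import Data.Fin using (Fin; toℕ)
open import Data.Fin.Subset using (Subset; _∈_; _∉_; _⊆_; _⊂_; _∪_; ⁅_⁆; ∣_∣; ⊤)
open import Data.Product using (Σ; ∃; ∃-syntax; _×_)
open import Relation.Binary.PropositionalEquality using (_≡_; _≢_)
open import Relation.Nullary using (¬_)

Presentation : ℕ → ℕ → Set
Presentation n r = Fin r → Subset n

PartialTransversal : ∀ {n r} → Presentation n r → Subset n → Set
PartialTransversal {n} {r} Y I =
  Σ (Fin n → Fin r) λ φ →
    (∀ e → e ∈ I → e ∈ Y (φ e)) ×
    (∀ e f → e ∈ I → f ∈ I → φ e ≡ φ f → e ≡ f)

Circuit : ∀ {n} → Subset n → (Subset n → Set) → Subset n → Set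
Circuit G Ind C = C ⊆ G × ¬ Ind C × (∀ D → D ⊂ C → Ind D)

IsRank : ∀ {n} → (Subset n → Set) → Subset n → ℕ → Set
IsRank Ind X k =
  (∃[ I ] (I ⊆ X × Ind I × ∣ I ∣ ≡ k)) ×
  (∀ I → I ⊆ X → Ind I → ∣ I ∣ ≤ k)

Flat : ∀ {n} → Subset n → (Subset n → Set) → Subset n → Set
Flat G Ind F =
  F ⊆ G × (∀ e → e ∈ G → e ∉ F → ∀ k → IsRank Ind F k → ¬ IsRank Ind (F ∪ ⁅ e ⁆) k)

RestrictInd : ∀ {n} → (Subset n → Set) → Subset n → Subset n → Set
RestrictInd Ind F X = X ⊆ F × Ind X

Connected : ∀ {n} → Subset n → (Subset n → Set) → Set
Connected G Ind =
  ∀ e f → e ∈ G → f ∈ G → e ≢ f → ∃[ C ] (Circuit G Ind C × e ∈ C × f ∈ C)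

ConnectedFlat : ∀ {n} → Subset n → (Subset n → Set) → Subset n → Set
ConnectedFlat G Ind F = Flat G Ind F × Connected F (RestrictInd Ind F)

support : ∀ {n r} → Presentation n r → Fin n → Fin r → Set
support Y e i = e ∈ Y i

supportSet : ∀ {n r} → Presentation n r → Subset n → Fin r → Set
supportSet Y X i = ∃[ e ] (e ∈ X × e ∈ Y i)

-- S ⊆ [r] is an interval {a, a+1, ..., b} (empty allowed when a > b).
IsInterval : ∀ {r} → (Fin r → Set) → Set
IsInterval {r} S = ∃[ a ] ∃[ b ] ∀ (i : Fin r) →
  (S i → a ≤ toℕ i × toℕ i ≤ b) × (a ≤ toℕ i → toℕ i ≤ b → S i)

TInd : ∀ {n r} → Presentation n r → Subset n → Set
TInd Y = PartialTransversal Y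

-- Both parts rest on one exchange argument. Let C be a circuit and T a set of indices
-- such that some z ∈ C has support meeting T while the elements of C whose supports
-- meet T can be matched into T. Completing that matching by a matching of C - z on the
-- remaining elements gives a matching of all of C, which is impossible.
--
-- (1) If j ∉ s(C) lies between two indices of s(C), take T = {t < j}. Every support is
-- an interval avoiding j, so an element meeting T has its whole support in T, and a
-- matching of C - b, where s(b) lies above j, matches these elements into T. For a
-- connected flat F, any two elements lie in a common circuit, so s(F) is convex too.
--
-- (2) Let φ match a maximum independent subset I of F. If some i ∈ s(F) were not a
-- φ-value, let T be the indices reachable from i by alternating paths. By maximality,
-- every element of F meeting T lies in I and has its φ-value in T; the exchange argument
-- applied to a circuit of F through an element whose support contains i is then
-- contradictory. Hence φ(I) covers s(F), so if s(e) ⊆ s(F), every partial transversal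
-- inside F ∪ {e} injects into I, and e ∉ F would contradict flatness.

module Submission where

open import Defs
open import Data.Nat using (ℕ; zero; suc; _≤_; _<_; z≤n; s≤s; _<?_)
open import Data.Nat.Properties using (≤-trans; <⇒≤; ≤∧≢⇒<; ≮⇒≥; <-irrefl; ≤-pred; <⇒≱; suc-injective; module ≤-Reasoning)
open import Data.Fin using (Fin; toℕ; zero; suc)
open import Data.Fin.Properties using (any?; toℕ-injective) renaming (_≟_ to _≟ᶠ_)
open import Data.Fin.Subset
  using (Subset; inside; outside; _∈_; _∉_; _⊆_; _∪_; _-_; ⁅_⁆; ∣_∣; ⊤; Nonempty)
  renaming (⊥ to ∅)
open import Data.Fin.Subset.Properties
  using (_∈?_; nonempty?; Empty-unique; ∣⊥∣≡0; p─⊥≡p; ∣p∣≤n; ⊥⊆; ∈⊤; p─q⊆p; x∈p∧x≢y⇒x∈p-y;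
         x∈p⇒p-x⊂p; x∈p⇒∣p-x∣<∣p∣; p⊂q⇒∣p∣<∣q∣; p⊆p∪q; x∈p∪q⁺; x∈p∪q⁻; x∈⁅x⁆; x∈⁅y⁆⇒x≡y)
open import Data.Product using (Σ; ∃; ∃-syntax; _×_; _,_; proj₁; proj₂)
open import Data.Sum using (_⊎_; inj₁; inj₂)
import Data.Sum as Sum
open import Data.Empty using (⊥; ⊥-elim)
open import Data.Vec using (_∷_; here; there)
open import Function using (_∘_)
open import Function.Bundles using (_⇔_; mk⇔)
open import Relation.Nullary using (yes; no; ¬_)
open import Relation.Nullary.Decidable using (_×-dec_; _⊎-dec_; decidable-stable; ¬¬-excluded-middle)
open import Relation.Unary using (Decidable)
open import Relation.Binary.PropositionalEquality using (_≡_; _≢_; refl; sym; trans; cong; subst; module ≡-Reasoning)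

x∉p-x : ∀ {n} {x : Fin n} (p : Subset n) → x ∉ p - x
x∉p-x {x = zero}  (_ ∷ p) ()
x∉p-x {x = suc x} (_ ∷ p) (there x∈p-x) = x∉p-x p x∈p-x

∣p∣≡1+∣p-x∣ : ∀ {n} {x : Fin n} {p : Subset n} → x ∈ p → ∣ p ∣ ≡ suc ∣ p - x ∣
∣p∣≡1+∣p-x∣ {x = zero}  {inside ∷ p}  here          = cong (suc ∘ ∣_∣) (sym (p─⊥≡p p))
∣p∣≡1+∣p-x∣ {x = suc x} {inside ∷ p}  (there x∈p) = cong suc (∣p∣≡1+∣p-x∣ x∈p)
∣p∣≡1+∣p-x∣ {x = suc x} {outside ∷ p} (there x∈p) = ∣p∣≡1+∣p-x∣ x∈p

0<∣p∣⇒nonempty : ∀ {n} {p : Subset n} → 0 < ∣ p ∣ → Nonempty p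
0<∣p∣⇒nonempty {n} {p} 0<∣p∣ with nonempty? p
... | yes ne = ne
... | no ¬ne = ⊥-elim (<-irrefl (sym (∣⊥∣≡0 n)) (subst (λ q → 0 < ∣ q ∣) (Empty-unique ¬ne) 0<∣p∣))

1<∣p∣⇒∃-other : ∀ {n} {p : Subset n} {x} → 1 < ∣ p ∣ → x ∈ p → ∃[ y ] (y ∈ p × y ≢ x)
1<∣p∣⇒∃-other {p = p} 1<∣p∣ x∈p with 0<∣p∣⇒nonempty (≤-pred (subst (1 <_) (∣p∣≡1+∣p-x∣ x∈p) 1<∣p∣))
... | y , y∈p-x = y , p─q⊆p p _ y∈p-x , λ { refl → x∉p-x p y∈p-x }

infix 4 _↪_

_↪_ : ∀ {m n} → Subset m → Subset n → Set
_↪_ {n = n} A B = Σ (∀ x → x ∈ A → Fin n) λ f →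
  (∀ x x∈A → f x x∈A ∈ B) × (∀ x y x∈A y∈A → f x x∈A ≡ f y y∈A → x ≡ y)

↪-remove : ∀ {m n} {A : Subset m} {B : Subset n} {x} → A ↪ B → x ∈ A → ∃[ y ] (y ∈ B × A - x ↪ B - y)
↪-remove {n = n} {A} {B} {x} (f , f∈B , f-inj) x∈A = f x x∈A , f∈B x x∈A , g , g∈B-fx , g-inj
  where
  ⊆A : ∀ {y} → y ∈ A - x → y ∈ A
  ⊆A = p─q⊆p A _
  g : ∀ y → y ∈ A - x → Fin n
  g y y∈A-x = f y (⊆A y∈A-x)
  g∈B-fx : ∀ y y∈A-x → g y y∈A-x ∈ B - f x x∈A
  g∈B-fx y y∈A-x = x∈p∧x≢y⇒x∈p-y (f∈B y _) λ fy≡fx →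
    x∉p-x A (subst (_∈ A - x) (f-inj y x _ x∈A fy≡fx) y∈A-x)
  g-inj : ∀ y z y∈A-x z∈A-x → g y y∈A-x ≡ g z z∈A-x → y ≡ z
  g-inj y z y∈A-x z∈A-x = f-inj y z (⊆A y∈A-x) (⊆A z∈A-x)

↪⇒∣≤∣ : ∀ {m n} {A : Subset m} {B : Subset n} → A ↪ B → ∣ A ∣ ≤ ∣ B ∣
↪⇒∣≤∣ A↪B = by-size _ refl A↪B
  where
  open ≤-Reasoning
  by-size : ∀ {m n} k {A : Subset m} {B : Subset n} → ∣ A ∣ ≡ k → A ↪ B → ∣ A ∣ ≤ ∣ B ∣
  by-size zero    ∣A∣≡0 _ = subst (_≤ _) (sym ∣A∣≡0) z≤n
  by-size (suc k) {A} {B} ∣A∣≡1+k A↪B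
    with x , x∈A ← 0<∣p∣⇒nonempty (subst (0 <_) (sym ∣A∣≡1+k) (s≤s z≤n))
    with y , y∈B , A-x↪B-y ← ↪-remove A↪B x∈A = begin
      ∣ A ∣          ≡⟨ ∣p∣≡1+∣p-x∣ x∈A ⟩
      suc ∣ A - x ∣  ≤⟨ s≤s (by-size k (suc-injective (trans (sym (∣p∣≡1+∣p-x∣ x∈A)) ∣A∣≡1+k)) A-x↪B-y) ⟩
      suc ∣ B - y ∣  ≤⟨ x∈p⇒∣p-x∣<∣p∣ y∈B ⟩
      ∣ B ∣          ∎

Convex : ∀ {r} → (Fin r → Set) → Set
Convex S = ∀ {i k} j → S i → S k → toℕ i ≤ toℕ j → toℕ j ≤ toℕ k → S j

IsInterval⇒Convex : ∀ {r} {S : Fin r → Set} → IsInterval S → Convex S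
IsInterval⇒Convex (a , b , S⇔) {i} {k} j Si Sk i≤j j≤k =
  proj₂ (S⇔ j) (≤-trans (proj₁ (proj₁ (S⇔ i) Si)) i≤j) (≤-trans j≤k (proj₂ (proj₁ (S⇔ k) Sk)))

empty⊎minimum : ∀ {r} {S : Fin r → Set} → Decidable S →
  (∀ i → ¬ S i) ⊎ ∃[ m ] (S m × ∀ i → S i → toℕ m ≤ toℕ i)
empty⊎minimum {zero}  S? = inj₁ λ ()
empty⊎minimum {suc r} S? with S? zero | empty⊎minimum (S? ∘ suc)
... | yes S0 | _                    = inj₂ (zero , S0 , λ _ _ → z≤n)
... | no ¬S0 | inj₁ ¬S              = inj₁ λ { zero → ¬S0 ; (suc i) → ¬S i }
... | no ¬S0 | inj₂ (m , Sm , m≤S) = inj₂ (suc m , Sm , λ { zero S0 → ⊥-elim (¬S0 S0) ; (suc i) Si → s≤s (m≤S i Si) })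

empty⊎maximum : ∀ {r} {S : Fin r → Set} → Decidable S →
  (∀ i → ¬ S i) ⊎ ∃[ m ] (S m × ∀ i → S i → toℕ i ≤ toℕ m)
empty⊎maximum {zero}  S? = inj₁ λ ()
empty⊎maximum {suc r} S? with S? zero | empty⊎maximum (S? ∘ suc)
... | _      | inj₂ (m , Sm , S≤m) = inj₂ (suc m , Sm , λ { zero _ → z≤n ; (suc i) Si → s≤s (S≤m i Si) })
... | yes S0 | inj₁ ¬S              = inj₂ (zero , S0 , λ { zero _ → z≤n ; (suc i) Si → ⊥-elim (¬S i Si) })
... | no ¬S0 | inj₁ ¬S              = inj₁ λ { zero → ¬S0 ; (suc i) → ¬S i }

Convex⇒IsInterval : ∀ {r} {S : Fin r → Set} → Decidable S → Convex S → IsInterval S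
Convex⇒IsInterval S? convex with empty⊎minimum S? | empty⊎maximum S?
... | inj₁ ¬S | _ = 1 , 0 , λ i → (⊥-elim ∘ ¬S i) , λ 1≤i i≤0 → ⊥-elim (<⇒≱ 1≤i i≤0)
... | inj₂ (m , Sm , _) | inj₁ ¬S = ⊥-elim (¬S m Sm)
... | inj₂ (m , Sm , m≤S) | inj₂ (M , SM , S≤M) =
  toℕ m , toℕ M , λ i → (λ Si → m≤S i Si , S≤M i Si) , convex i Sm SM

¬¬-choice : ∀ {n} {P : Fin n → Set} → (∀ x → ¬ ¬ P x) → ¬ ¬ (∀ x → P x)
¬¬-choice {zero}  _   k = k λ ()
¬¬-choice {suc n} ¬¬P k = ¬¬P zero λ P0 → ¬¬-choice (¬¬P ∘ suc) λ P+ → k λ { zero → P0 ; (suc x) → P+ x }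

MaximumIndependent : ∀ {n} → (Subset n → Set) → Subset n → Subset n → Set
MaximumIndependent Ind F I = I ⊆ F × Ind I × (∀ J → J ⊆ F → Ind J → ∣ J ∣ ≤ ∣ I ∣)

-- Ind is not assumed decidable, so a maximum independent subset is only obtained under
-- double negation; every use has goal ⊥.
¬¬-maximumIndependent : ∀ {n} (Ind : Subset n → Set) (F : Subset n) → Ind ∅ →
  ¬ ¬ (∃ (MaximumIndependent Ind F))
¬¬-maximumIndependent {n} Ind F Ind∅ no-maximum =
  of-size (suc n) λ (I , _ , _ , n<∣I∣) → <⇒≱ n<∣I∣ (∣p∣≤n I)
  where
  Larger : Subset n → Set
  Larger I = ∃[ J ] (J ⊆ F × Ind J × ∣ I ∣ < ∣ J ∣)
  of-size : ∀ k → ¬ ¬ (∃[ I ] (I ⊆ F × Ind I × k ≤ ∣ I ∣))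
  of-size zero    none = none (∅ , ⊥⊆ , Ind∅ , z≤n)
  of-size (suc k) none = of-size k λ (I , I⊆F , Ind-I , k≤∣I∣) → ¬¬-excluded-middle {A = Larger I} λ
    { (yes (J , J⊆F , Ind-J , ∣I∣<∣J∣)) → none (J , J⊆F , Ind-J , ≤-trans (s≤s k≤∣I∣) ∣I∣<∣J∣)
    ; (no ¬larger) → no-maximum (I , I⊆F , Ind-I , λ J J⊆F Ind-J → ≮⇒≥ λ lt → ¬larger (J , J⊆F , Ind-J , lt)) }

MaximumIndependent⇒IsRank : ∀ {n} {Ind : Subset n → Set} {F I} → MaximumIndependent Ind F I → IsRank Ind F ∣ I ∣
MaximumIndependent⇒IsRank (I⊆F , Ind-I , maximum) = (_ , I⊆F , Ind-I , refl) , maximum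

restriction-circuit⇒circuit : ∀ {n} {F C : Subset n} {Ind : Subset n → Set} →
  Circuit F (RestrictInd Ind F) C → Circuit F Ind C
restriction-circuit⇒circuit (C⊆F , dependent , minimal) =
  C⊆F , (λ Ind-C → dependent (C⊆F , Ind-C)) , λ D D⊂C → proj₂ (minimal D D⊂C)

circuit-through : ∀ {n} {F : Subset n} {Ind : Subset n → Set} {z} →
  Connected F Ind → 1 < ∣ F ∣ → z ∈ F → ∃[ C ] (Circuit F Ind C × z ∈ C)
circuit-through connected 1<∣F∣ z∈F
  with x , x∈F , x≢z ← 1<∣p∣⇒∃-other 1<∣F∣ z∈F
  with C , circuit , z∈C , _ ← connected _ x z∈F x∈F (x≢z ∘ sym) = C , circuit , z∈C

module _ {n r} (Y : Presentation n r) where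

  Matches : (Fin n → Set) → (Fin n → Fin r) → Set
  Matches P φ = (∀ e → P e → e ∈ Y (φ e)) × (∀ e f → P e → P f → φ e ≡ φ f → e ≡ f)

  Matches-⊆ : ∀ {P Q : Fin n → Set} {φ} → (∀ e → P e → Q e) → Matches Q φ → Matches P φ
  Matches-⊆ P⊆Q (φ-into , φ-inj) =
    (λ e → φ-into e ∘ P⊆Q e) , λ e f Pe Pf → φ-inj e f (P⊆Q e Pe) (P⊆Q f Pf)

  TInd-⊆ : ∀ {I J} → J ⊆ I → TInd Y I → TInd Y J
  TInd-⊆ J⊆I (φ , φ-matches) = φ , Matches-⊆ (λ _ → J⊆I) φ-matches

  join-matchings : ∀ {P L : Fin n → Set} {ψ χ} → Decidable L →
    Matches (λ e → P e × L e) ψ → Matches (λ e → P e × ¬ L e) χ →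
    (∀ e f → P e × L e → P f × ¬ L f → ψ e ≢ χ f) → ∃ (Matches P)
  join-matchings {P} {L} {ψ} {χ} L? (ψ-into , ψ-inj) (χ-into , χ-inj) disjoint = ω , ω-into , ω-inj
    where
    ω : Fin n → Fin r
    ω e with L? e
    ... | yes _ = ψ e
    ... | no  _ = χ e
    ω-into : ∀ e → P e → e ∈ Y (ω e)
    ω-into e Pe with L? e
    ... | yes Le = ψ-into e (Pe , Le)
    ... | no ¬Le = χ-into e (Pe , ¬Le)
    ω-inj : ∀ e f → P e → P f → ω e ≡ ω f → e ≡ f
    ω-inj e f Pe Pf ωe≡ωf with L? e | L? f
    ... | yes Le | yes Lf = ψ-inj e f (Pe , Le) (Pf , Lf) ωe≡ωf
    ... | yes Le | no ¬Lf = ⊥-elim (disjoint e f (Pe , Le) (Pf , ¬Lf) ωe≡ωf)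
    ... | no ¬Le | yes Lf = ⊥-elim (disjoint f e (Pf , Lf) (Pe , ¬Le) (sym ωe≡ωf))
    ... | no ¬Le | no ¬Lf = χ-inj e f (Pe , ¬Le) (Pf , ¬Lf) ωe≡ωf

  redirect : Fin n → Fin r → (Fin n → Fin r) → Fin n → Fin r
  redirect g u φ e with e ≟ᶠ g
  ... | yes _ = u
  ... | no  _ = φ e

  redirect-matches : ∀ {P : Fin n → Set} {φ g u} → Matches P φ → g ∈ Y u → (∀ e → P e → φ e ≢ u) →
    Matches (λ e → P e ⊎ e ≡ g) (redirect g u φ)
  redirect-matches {P} {φ} {g} {u} (φ-into , φ-inj) g∈Yu u-free = into , inj
    where
    other : ∀ {e} → P e ⊎ e ≡ g → e ≢ g → P e
    other (inj₁ Pe)   _   = Pe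
    other (inj₂ e≡g) e≢g = ⊥-elim (e≢g e≡g)
    into : ∀ e → P e ⊎ e ≡ g → e ∈ Y (redirect g u φ e)
    into e Pe⊎e≡g with e ≟ᶠ g
    ... | yes refl = g∈Yu
    ... | no  e≢g  = φ-into e (other Pe⊎e≡g e≢g)
    inj : ∀ e f → P e ⊎ e ≡ g → P f ⊎ f ≡ g → redirect g u φ e ≡ redirect g u φ f → e ≡ f
    inj e f Pe⊎ Pf⊎ eq with e ≟ᶠ g | f ≟ᶠ g
    ... | yes e≡g | yes f≡g = trans e≡g (sym f≡g)
    ... | yes _   | no  f≢g = ⊥-elim (u-free f (other Pf⊎ f≢g) (sym eq))
    ... | no  e≢g | yes _   = ⊥-elim (u-free e (other Pe⊎ e≢g) eq)
    ... | no  e≢g | no  f≢g = φ-inj e f (other Pe⊎ e≢g) (other Pf⊎ f≢g) eq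

  Meets : (Fin r → Set) → Fin n → Set
  Meets T e = ∃[ t ] (T t × e ∈ Y t)

  meets? : ∀ {T} → Decidable T → Decidable (Meets T)
  meets? T? e = any? λ t → T? t ×-dec (e ∈? Y t)

  supportSet? : ∀ X → Decidable (supportSet Y X)
  supportSet? X i = any? λ e → (e ∈? X) ×-dec (e ∈? Y i)

  circuit-¬matches-into : ∀ {G C z ψ} (T : Fin r → Set) → Decidable (Meets T) →
    Circuit G (TInd Y) C → z ∈ C → Meets T z →
    Matches (λ c → c ∈ C × Meets T c) ψ → (∀ c → c ∈ C × Meets T c → T (ψ c)) → ⊥
  circuit-¬matches-into {C = C} {z} {ψ} T meets-T? (_ , dependent , minimal) z∈C Tz ψ-matches ψ∈T =
    dependent (join-matchings meets-T? ψ-matches (Matches-⊆ avoid-z χ-matches) disjoint)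
    where
    C-z-independent : TInd Y (C - z)
    C-z-independent = minimal (C - z) (x∈p⇒p-x⊂p z∈C)
    χ : Fin n → Fin r
    χ = proj₁ C-z-independent
    χ-matches : Matches (_∈ C - z) χ
    χ-matches = proj₂ C-z-independent
    avoid-z : ∀ c → c ∈ C × ¬ Meets T c → c ∈ C - z
    avoid-z c (c∈C , ¬Tc) = x∈p∧x≢y⇒x∈p-y c∈C λ { refl → ¬Tc Tz }
    disjoint : ∀ c d → c ∈ C × Meets T c → d ∈ C × ¬ Meets T d → ψ c ≢ χ d
    disjoint c d Tc (d∈C , ¬Td) ψc≡χd =
      ¬Td (ψ c , ψ∈T c Tc , subst (λ t → d ∈ Y t) (sym ψc≡χd) (proj₁ χ-matches d (avoid-z d (d∈C , ¬Td))))

  circuit-support-gap-free : (∀ e → IsInterval (support Y e)) → ∀ {G C} → Circuit G (TInd Y) C →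
    ∀ {i k} j → supportSet Y C i → supportSet Y C k → toℕ i ≤ toℕ j → toℕ j ≤ toℕ k → ¬ ¬ supportSet Y C j
  circuit-support-gap-free intervals {C = C} circuit {i} j (a , a∈C , a∈Yi) (b , b∈C , b∈Yk) i≤j j≤k j∉sC =
    circuit-¬matches-into Below (meets? Below?) circuit a∈C (i , i<j , a∈Yi) ψ-matches ψ-below
    where
    Below : Fin r → Set
    Below t = toℕ t < toℕ j
    Below? : Decidable Below
    Below? t = toℕ t <? toℕ j
    straddles : ∀ {c t t′} → c ∈ C → c ∈ Y t → c ∈ Y t′ → Below t → toℕ j ≤ toℕ t′ → ⊥
    straddles c∈C c∈Yt c∈Yt′ t<j j≤t′ =
      j∉sC (_ , c∈C , IsInterval⇒Convex (intervals _) j c∈Yt c∈Yt′ (<⇒≤ t<j) j≤t′)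
    i<j : Below i
    i<j = ≤∧≢⇒< i≤j λ i≡j → j∉sC (a , a∈C , subst (λ t → a ∈ Y t) (toℕ-injective i≡j) a∈Yi)
    b-above : ¬ Meets Below b
    b-above (t , t<j , b∈Yt) = straddles b∈C b∈Yt b∈Yk t<j j≤k
    C-b-independent : TInd Y (C - b)
    C-b-independent = proj₂ (proj₂ circuit) (C - b) (x∈p⇒p-x⊂p b∈C)
    ψ : Fin n → Fin r
    ψ = proj₁ C-b-independent
    avoid-b : ∀ c → c ∈ C × Meets Below c → c ∈ C - b
    avoid-b c (c∈C , below) = x∈p∧x≢y⇒x∈p-y c∈C λ { refl → b-above below }
    ψ-matches : Matches (λ c → c ∈ C × Meets Below c) ψ
    ψ-matches = Matches-⊆ avoid-b (proj₂ C-b-independent)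
    ψ-below : ∀ c → c ∈ C × Meets Below c → Below (ψ c)
    ψ-below c c∈C×below@(c∈C , t , t<j , c∈Yt) = decidable-stable (Below? (ψ c)) λ ψc≮j →
      straddles c∈C c∈Yt (proj₁ ψ-matches c c∈C×below) t<j (≮⇒≥ ψc≮j)

  circuit-support-convex : (∀ e → IsInterval (support Y e)) →
    ∀ {G C} → Circuit G (TInd Y) C → Convex (supportSet Y C)
  circuit-support-convex intervals {C = C} circuit j sCi sCk i≤j j≤k =
    decidable-stable (supportSet? C j) (circuit-support-gap-free intervals circuit j sCi sCk i≤j j≤k)

  connected-support-convex : (∀ e → IsInterval (support Y e)) →
    ∀ {F} → Connected F (RestrictInd (TInd Y) F) → Convex (supportSet Y F)
  connected-support-convex intervals connected j (x , x∈F , x∈Yi) (y , y∈F , y∈Yk) i≤j j≤k with x ≟ᶠ y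
  ... | yes refl = x , x∈F , IsInterval⇒Convex (intervals x) j x∈Yi y∈Yk i≤j j≤k
  ... | no x≢y
    with C , circuit , x∈C , y∈C ← connected x y x∈F y∈F x≢y
    with c , c∈C , c∈Yj ← circuit-support-convex intervals (restriction-circuit⇒circuit circuit)
                            j (x , x∈C , x∈Yi) (y , y∈C , y∈Yk) i≤j j≤k
    = c , proj₁ circuit c∈C , c∈Yj

  module AlternatingPaths {F I : Subset n} {φ : Fin n → Fin r}
    (I-maximum : MaximumIndependent (TInd Y) F I) (φ-matches : Matches (_∈ I) φ)
    (i : Fin r) (i-free : ∀ h → h ∈ I → φ h ≢ i) where

    Reach : ℕ → Fin r → Set
    Reach zero    u = u ≡ i
    Reach (suc k) u = Reach k u ⊎ ∃[ g ] (g ∈ I × φ g ≡ u × Meets (Reach k) g)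

    reach? : ∀ k → Decidable (Reach k)
    reach? zero    u = u ≟ᶠ i
    reach? (suc k) u = reach? k u ⊎-dec any? λ g → (g ∈? I) ×-dec (φ g ≟ᶠ u) ×-dec meets? (reach? k) g

    record Rematching (k : ℕ) (u : Fin r) : Set where
      constructor rematching
      field
        ψ         : Fin n → Fin r
        ψ-matches : Matches (_∈ I) ψ
        ψ-avoids  : ∀ h → h ∈ I → ψ h ≢ u
        ψ-reach   : ∀ h → h ∈ I → ψ h ≡ φ h ⊎ Reach k (ψ h)

    rematch : ∀ k u → Reach k u → Rematching k u
    rematch zero    u refl = rematching φ φ-matches i-free λ _ _ → inj₁ refl
    rematch (suc k) u reach with reach? k u
    ... | yes earlier = rematching ψ ψ-matches ψ-avoids λ h h∈I → Sum.map₂ inj₁ (ψ-reach h h∈I)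
      where open Rematching (rematch k u earlier)
    -- u is reached for the first time at step k + 1 through u = φ g; moving g to its
    -- predecessor t frees u, and no other element of I sits at u.
    ... | no first with reach
    ...   | inj₁ earlier = ⊥-elim (first earlier)
    ...   | inj₂ (g , g∈I , φg≡u , t , reach-t , g∈Yt) = rematching ψ′ ψ′-matches ψ′-avoids ψ′-reach
      where
      open Rematching (rematch k t reach-t)
      ψ′ : Fin n → Fin r
      ψ′ = redirect g t ψ
      ψ′-matches : Matches (_∈ I) ψ′
      ψ′-matches = Matches-⊆ (λ _ → inj₁) (redirect-matches ψ-matches g∈Yt ψ-avoids)
      ψ′-avoids : ∀ h → h ∈ I → ψ′ h ≢ u
      ψ′-avoids h h∈I with h ≟ᶠ g | ψ-reach h h∈I
      ... | yes _   | _              = λ t≡u → first (subst (Reach k) t≡u reach-t)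
      ... | no  h≢g | inj₁ ψh≡φh     = λ ψh≡u →
        h≢g (proj₂ φ-matches h g h∈I g∈I (trans (sym ψh≡φh) (trans ψh≡u (sym φg≡u))))
      ... | no  _   | inj₂ reach-ψh = λ ψh≡u → first (subst (Reach k) ψh≡u reach-ψh)
      ψ′-reach : ∀ h → h ∈ I → ψ′ h ≡ φ h ⊎ Reach (suc k) (ψ′ h)
      ψ′-reach h h∈I with h ≟ᶠ g
      ... | yes _ = inj₂ (inj₁ reach-t)
      ... | no  _ = Sum.map₂ inj₁ (ψ-reach h h∈I)

    reached-support⊆I : ∀ {k u f} → Reach k u → f ∈ F → f ∈ Y u → f ∈ I
    reached-support⊆I {k} {u} {f} reach f∈F f∈Yu = decidable-stable (f ∈? I) λ f∉I →
      <⇒≱ (p⊂q⇒∣p∣<∣q∣ (p⊆p∪q ⁅ f ⁆ , f , x∈p∪q⁺ (inj₂ (x∈⁅x⁆ f)) , f∉I))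
          (proj₂ (proj₂ I-maximum) (I ∪ ⁅ f ⁆) I+f⊆F (redirect f u ψ , I+f-matches))
      where
      open Rematching (rematch k u reach)
      I+f⊆F : I ∪ ⁅ f ⁆ ⊆ F
      I+f⊆F e∈I+f with x∈p∪q⁻ I ⁅ f ⁆ e∈I+f
      ... | inj₁ e∈I   = proj₁ I-maximum e∈I
      ... | inj₂ e∈⁅f⁆ = subst (_∈ F) (sym (x∈⁅y⁆⇒x≡y f e∈⁅f⁆)) f∈F
      I+f-matches : Matches (_∈ I ∪ ⁅ f ⁆) (redirect f u ψ)
      I+f-matches = Matches-⊆ (λ e e∈I+f → Sum.map₂ (x∈⁅y⁆⇒x≡y f) (x∈p∪q⁻ I ⁅ f ⁆ e∈I+f))
                              (redirect-matches ψ-matches f∈Yu ψ-avoids)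

    Reachable : Fin r → Set
    Reachable u = ∃[ k ] Reach k u

    free-index-∉-support : Connected F (RestrictInd (TInd Y) F) → 1 < ∣ F ∣ → ¬ supportSet Y F i
    free-index-∉-support connected 1<∣F∣ (z , z∈F , z∈Yi)
      with C , circuit , z∈C ← circuit-through connected 1<∣F∣ z∈F =
      ¬¬-choice (λ _ → ¬¬-excluded-middle) λ meets-reachable? →
        circuit-¬matches-into Reachable meets-reachable? (restriction-circuit⇒circuit circuit) z∈C
          (i , (0 , refl) , z∈Yi) (Matches-⊆ in-I φ-matches) φ-reachable
      where
      in-I : ∀ c → c ∈ C × Meets Reachable c → c ∈ I
      in-I c (c∈C , t , (k , reach-t) , c∈Yt) = reached-support⊆I reach-t (proj₁ circuit c∈C) c∈Yt
      φ-reachable : ∀ c → c ∈ C × Meets Reachable c → Reachable (φ c)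
      φ-reachable c c∈C×meets@(_ , t , (k , reach-t) , c∈Yt) =
        suc k , inj₂ (c , in-I c c∈C×meets , refl , t , reach-t , c∈Yt)

  maximum-matching-covers-support : ∀ {F I φ} → Connected F (RestrictInd (TInd Y) F) → 1 < ∣ F ∣ →
    MaximumIndependent (TInd Y) F I → Matches (_∈ I) φ →
    ∀ i → supportSet Y F i → ∃[ h ] (h ∈ I × φ h ≡ i)
  maximum-matching-covers-support {I = I} {φ} connected 1<∣F∣ I-maximum φ-matches i i∈sF =
    decidable-stable (any? λ h → (h ∈? I) ×-dec (φ h ≟ᶠ i)) λ uncovered →
      AlternatingPaths.free-index-∉-support I-maximum φ-matches i
        (λ h h∈I φh≡i → uncovered (h , h∈I , φh≡i)) connected 1<∣F∣ i∈sF

  covered-support⇒rank-bound : ∀ {X I φ} → (∀ i → supportSet Y X i → ∃[ h ] (h ∈ I × φ h ≡ i)) →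
    ∀ J → J ⊆ X → TInd Y J → ∣ J ∣ ≤ ∣ I ∣
  covered-support⇒rank-bound {I = I} {φ} covered J J⊆X (ψ , ψ-into , ψ-inj) = ↪⇒∣≤∣ (f , f∈I , f-inj)
    where
    preimage : ∀ x → x ∈ J → ∃[ h ] (h ∈ I × φ h ≡ ψ x)
    preimage x x∈J = covered (ψ x) (x , J⊆X x∈J , ψ-into x x∈J)
    f : ∀ x → x ∈ J → Fin n
    f x x∈J = proj₁ (preimage x x∈J)
    f∈I : ∀ x x∈J → f x x∈J ∈ I
    f∈I x x∈J = proj₁ (proj₂ (preimage x x∈J))
    f-inj : ∀ x y x∈J y∈J → f x x∈J ≡ f y y∈J → x ≡ y
    f-inj x y x∈J y∈J fx≡fy = ψ-inj x y x∈J y∈J (begin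
      ψ x             ≡⟨ sym (proj₂ (proj₂ (preimage x x∈J))) ⟩
      φ (f x x∈J)     ≡⟨ cong φ fx≡fy ⟩
      φ (f y y∈J)     ≡⟨ proj₂ (proj₂ (preimage y y∈J)) ⟩
      ψ y             ∎)
      where open ≡-Reasoning

  connected-flat-support-closed : ∀ {F} → ConnectedFlat ⊤ (TInd Y) F → 1 < ∣ F ∣ →
    ∀ e → (∀ i → support Y e i → supportSet Y F i) → e ∈ F
  connected-flat-support-closed {F} (flat , connected) 1<∣F∣ e sₑ⊆sF =
    decidable-stable (e ∈? F) λ e∉F →
      ¬¬-maximumIndependent (TInd Y) F ∅-independent λ (I , I-maximum) →
        proj₂ flat e ∈⊤ e∉F ∣ I ∣ (MaximumIndependent⇒IsRank I-maximum) (rank-F+e I-maximum)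
    where
    -- Not automatic: a matching is a total map Fin n → Fin r, which does not exist when
    -- r = 0 < n; one is borrowed from the independent set C - z.
    ∅-independent : TInd Y ∅
    ∅-independent with z , z∈F ← 0<∣p∣⇒nonempty (≤-trans (s≤s z≤n) 1<∣F∣)
      with C , (_ , _ , minimal) , z∈C ← circuit-through connected 1<∣F∣ z∈F
      = TInd-⊆ ⊥⊆ (proj₂ (minimal (C - z) (x∈p⇒p-x⊂p z∈C)))
    sF+e⊆sF : ∀ {i} → supportSet Y (F ∪ ⁅ e ⁆) i → supportSet Y F i
    sF+e⊆sF (x , x∈F+e , x∈Yi) with x∈p∪q⁻ F ⁅ e ⁆ x∈F+e
    ... | inj₁ x∈F   = x , x∈F , x∈Yi
    ... | inj₂ x∈⁅e⁆ = sₑ⊆sF _ (subst (λ y → y ∈ Y _) (x∈⁅y⁆⇒x≡y e x∈⁅e⁆) x∈Yi)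
    rank-F+e : ∀ {I} → MaximumIndependent (TInd Y) F I → IsRank (TInd Y) (F ∪ ⁅ e ⁆) ∣ I ∣
    rank-F+e I-maximum@(I⊆F , I-independent@(_ , φ-matches) , _) =
      (_ , (λ h∈I → x∈p∪q⁺ (inj₁ (I⊆F h∈I))) , I-independent , refl) ,
      covered-support⇒rank-bound λ i i∈sF+e →
        maximum-matching-covers-support connected 1<∣F∣ I-maximum φ-matches i (sF+e⊆sF i∈sF+e)

lemma4p6 : ∀ {n r} (Y : Presentation n r) →
    (∀ e → IsInterval (support Y e)) →
    (∀ C → Circuit ⊤ (TInd Y) C → IsInterval (supportSet Y C)) ×
    (∀ F → ConnectedFlat ⊤ (TInd Y) F → 1 < ∣ F ∣ →
      IsInterval (supportSet Y F) ×
      (∀ e → e ∈ F ⇔ (∀ i → support Y e i → supportSet Y F i)))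
lemma4p6 Y intervals =
  (λ C circuit → Convex⇒IsInterval (supportSet? Y C) (circuit-support-convex Y intervals circuit)) ,
  λ F connected-flat 1<∣F∣ →
    Convex⇒IsInterval (supportSet? Y F) (connected-support-convex Y intervals (proj₂ connected-flat)) ,
    λ e → mk⇔ (λ e∈F i e∈Yi → e , e∈F , e∈Yi) (connected-flat-support-closed Y connected-flat 1<∣F∣ e)
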